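{- For all umbrae $\alpha,\gamma$ and every integer $n\geq 1$, \[ D_\gamma\,\mathrm{ab}_n(\gamma,\alpha)\simeq n\,\mathrm{ab}_{n-1}(\gamma+\alpha',\alpha), \] where $\mathrm{ab}_m(\gamma,\alpha)=\gamma(\gamma+m\boldsymbol{\cdot}\alpha)^{m-1}$ and $\alpha'$ is an umbra similar to $\alpha$ and distinct from all other umbrae involved.
   Context: Umbral calculus setting. Fix a finite set $\mathbf{x}$ of commuting variables and a further variable $z$. To every formal power series $f(z)\in\mathbb{C}[\mathbf{x}][[z]]$ with $f(0)=1$ a symbol (its umbra) is attached. The evaluation $E$ is the $\mathbb{C}[\mathbf{x}]$-linear functional on polynomials in umbrae with coefficients in $\mathbb{C}[\mathbf{x}]$ such that $E[\alpha^n]=n![z^n]f(z)$ when $\alpha$ is the umbra of $f$, and $E[\alpha^n\gamma^m\cdots\delta^l]=E[\alpha^n]E[\gamma^m]\cdots E[\delta^l]$ whenever $\alpha,\gamma,\dots,\delta$ are pairwise distinct umbrae (uncorrelation). Elements of $\mathbb{C}[\mathbf{x}]$ are constants for $E$. Write $\mathbf p\simeq\mathbf q$ if $E[\mathbf p]=E[\mathbf q]$, and $\mathbf p\equiv\mathbf q$ ($\mathbf p$ similar to $\mathbf q$) if $\mathbf p^n\simeq\mathbf q^n$ for all $n\ge 0$. For an umbral polynomial $\mathbf p$ let $f_{\mathbf p}(z)=E[e^{\mathbf p z}]=\sum_{n\ge0}E[\mathbf p^n]z^n/n!$. Auxiliary umbrae (treated as further umbrae, uncorrelated with all other distinct umbrae):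 for umbral polynomials $\mathbf p,\mathbf q$, the dot-product umbra $\mathbf p\boldsymbol{\cdot}\mathbf q$ has $f_{\mathbf p\boldsymbol{\cdot}\mathbf q}(z)=f_{\mathbf p}(\log f_{\mathbf q}(z))$; in particular for a scalar $a$, $f_{a\boldsymbol{\cdot}\alpha}(z)=f_\alpha(z)^a$, and for a positive integer $n$, $n\boldsymbol{\cdot}\alpha\equiv\alpha'+\alpha''+\cdots+\alpha^{(n)}$ with $\alpha',\dots,\alpha^{(n)}$ distinct umbrae similar to $\alpha$. Distinct letters denote distinct (uncorrelated) umbrae. The umbral Abel polynomial is $\mathrm{ab}_n(\gamma,\alpha)=\gamma(\gamma+n\boldsymbol{\cdot}\alpha)^{n-1}$ for $n\ge1$, with the convention $\mathrm{ab}_0=1$. $D_\gamma$ denotes formal differentiation with respect to $\gamma$ (i.e. $D_\gamma\gamma^n=n\gamma^{n-1}$, other umbrae treated as constants), applied before evaluation. -}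

module Defs where

open import Algebra.Bundles using (CommutativeRing)
open import Data.Nat as ℕ using (ℕ; zero; suc; _∸_)
open import Data.Nat.Combinatorics using (_C_)
open import Data.Fin using (Fin; zero; suc; _≟_)
open import Data.Vec as V using (Vec; []; _∷_)
open import Data.List as L using (List; []; _∷_; _++_)
open import Data.Product using (_×_; _,_)
open import Relation.Nullary using (yes; no)

-- Umbral calculus over a commutative coefficient ring R (playing the role of ℂ[x]).
-- Umbral polynomials with k umbrae (atoms, indexed by Fin k): finite formal
-- sums of terms  c · u₀^e₀ ⋯ u_{k-1}^e_{k-1}  with c ∈ R.
-- Distinct indices = distinct (uncorrelated) umbrae.
module Umbral {c ℓ} (R : CommutativeRing c ℓ) where
  open CommutativeRing R using (_≈_; _+_; _*_; 0#; 1#) renaming (Carrier to A)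

  _×ₙ_ : ℕ → A → A
  zero ×ₙ x = 0#
  suc n ×ₙ x = x + (n ×ₙ x)

  Monomial : ℕ → Set
  Monomial k = Vec ℕ k

  UPoly : ℕ → Set c
  UPoly k = List (A × Monomial k)

  const : ∀ {k} → A → UPoly k
  const a = (a , V.replicate _ 0) ∷ []

  1ᵖ : ∀ {k} → UPoly k
  1ᵖ = const 1#

  atom : ∀ {k} → Fin k → UPoly k
  atom i = (1# , V.tabulate (λ j → indicator j)) ∷ []
    where
    indicator : _ → ℕ
    indicator j with i ≟ j
    ... | yes _ = 1
    ... | no _ = 0

  infixl 6 _⊕_
  infixl 7 _⊗_
  _⊕_ : ∀ {k} → UPoly k → UPoly k → UPoly k
  _⊕_ = _++_

  _⊗_ : ∀ {k} → UPoly k → UPoly k → UPoly k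
  p ⊗ q = L.concatMap (λ { (a , m) → L.map (λ { (b , m′) → (a * b , V.zipWith ℕ._+_ m m′) }) q }) p

  _^ᵖ_ : ∀ {k} → UPoly k → ℕ → UPoly k
  p ^ᵖ zero = 1ᵖ
  p ^ᵖ suc n = p ⊗ (p ^ᵖ n)

  D : ∀ {k} → Fin k → UPoly k → UPoly k
  D i = L.map (λ { (a , m) → (V.lookup m i ×ₙ a , V.updateAt m i ℕ.pred) })

  -- moment sequences: u ↦ (E[u^n])_n
  Moments : Set c
  Moments = ℕ → A

  -- evaluation of a monomial by uncorrelation: product of moments of distinct umbrae
  evalMon : ∀ {k} → (Fin k → Moments) → Monomial k → A
  evalMon μ [] = 1#
  evalMon μ (e ∷ m) = μ zero e * evalMon (λ i → μ (suc i)) m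

  E : ∀ {k} → (Fin k → Moments) → UPoly k → A
  E μ [] = 0#
  E μ ((a , m) ∷ p) = a * evalMon μ m + E μ p

  infix 4 _≃⟨_⟩_
  _≃⟨_⟩_ : ∀ {k} → UPoly k → (Fin k → Moments) → UPoly k → Set ℓ
  p ≃⟨ μ ⟩ q = E μ p ≈ E μ q

  sumTo : ℕ → (ℕ → A) → A
  sumTo zero f = f 0
  sumTo (suc k) f = sumTo k f + f (suc k)

  -- moments of the dot-product umbra n·α, n ∈ ℕ:
  -- 0·α ≡ ε (moments 1,0,0,…) and (n+1)·α ≡ α' + n·α with α' ≡ α uncorrelated.
  dotMoments : ℕ → Moments → Moments
  dotMoments zero a zero = 1#
  dotMoments zero a (suc k) = 0#
  dotMoments (suc n) a k = sumTo k (λ j → (k C j) ×ₙ (a j * dotMoments n a (k ∸ j)))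

  -- umbral Abel polynomial ab_m(p, α) = p (p + m·α)^(m-1), ab_0 = 1;
  -- the second argument is the (auxiliary) umbra m·α.
  ab : ∀ {k} → ℕ → UPoly k → UPoly k → UPoly k
  ab zero p d = 1ᵖ
  ab (suc m) p d = p ⊗ ((p ⊕ d) ^ᵖ m)

  γᵘ α′ᵘ nαᵘ n-1αᵘ : Fin 4
  γᵘ = zero
  α′ᵘ = suc zero
  nαᵘ = suc (suc zero)
  n-1αᵘ = suc (suc (suc zero))

  abelEnv : ℕ → Moments → Moments → Fin 4 → Moments
  abelEnv n a g zero = g
  abelEnv n a g (suc zero) = a
  abelEnv n a g (suc (suc zero)) = dotMoments n a
  abelEnv n a g (suc (suc (suc zero))) = dotMoments (n ∸ 1) a

module Submission where

-- Every umbra is determined by its moment sequence, which we read as the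
-- exponential generating function Σ_k f_k z^k/k!.  Then the product of
-- uncorrelated umbrae is the binomial convolution ⋆ of moment sequences,
-- multiplying by an umbra shifts moments (differentiation ∂), the
-- derivative D_γ multiplies the generating function of γ by z, and the
-- moments of n·α are the n-th ⋆-power of those of α.

open import Defs
open import Algebra.Bundles using (CommutativeRing)
import Algebra.Properties.CommutativeSemigroup as CommSemigroupProps
import Algebra.Properties.CommutativeMonoid.Mult as CommMonoidMult
import Algebra.Properties.Semiring.Mult as SemiringMult
open import Data.Nat as ℕ using (ℕ; zero; suc; _≤_; _∸_; z≤n)
import Data.Nat.Properties as ℕP
open import Data.Nat.Combinatorics using (_C_; nCk+nC[k+1]≡[n+1]C[k+1]; k>n⇒nCk≡0)
open import Data.Fin using (Fin; zero; suc)
open import Data.Vec as V using (Vec; []; _∷_)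
import Data.Vec.Properties as VP
open import Data.List as L using ([]; _∷_)
open import Data.Product as Prod using (_,_)
import Relation.Binary.PropositionalEquality as Eq

module AbelCalculus {c ℓ} (R : CommutativeRing c ℓ) where
  open CommutativeRing R hiding (zero) renaming (Carrier to A)
  open Umbral R
  open SemiringMult semiring using (_×_; ×-congʳ; ×-congˡ; ×-homo-+; ×-homo-1; ×-assocˡ; ×-comm-*; ×-assoc-*)
  open CommMonoidMult +-commutativeMonoid using (×-distrib-+)
  open CommSemigroupProps +-commutativeSemigroup using (interchange; x∙yz≈y∙xz; xy∙z≈xz∙y)
  open import Relation.Binary.Reasoning.Setoid setoid

  ×ₙ≡× : ∀ n x → n ×ₙ x Eq.≡ n × x
  ×ₙ≡× zero x = Eq.refl
  ×ₙ≡× (suc n) x = Eq.cong (x +_) (×ₙ≡× n x)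

  ×-swap : ∀ m n x → m × (n × x) ≈ n × (m × x)
  ×-swap m n x = trans (×-assocˡ x m n) (trans (×-congˡ (ℕP.*-comm m n)) (sym (×-assocˡ x n m)))

  sum-cong : ∀ k {F G : ℕ → A} → (∀ j → j ≤ k → F j ≈ G j) → sumTo k F ≈ sumTo k G
  sum-cong zero F≈G = F≈G 0 z≤n
  sum-cong (suc k) F≈G =
    +-cong (sum-cong k (λ j j≤k → F≈G j (ℕP.m≤n⇒m≤1+n j≤k))) (F≈G (suc k) ℕP.≤-refl)

  sum-+ : ∀ k (F G : ℕ → A) → sumTo k (λ j → F j + G j) ≈ sumTo k F + sumTo k G
  sum-+ zero F G = refl
  sum-+ (suc k) F G = trans (+-congʳ (sum-+ k F G)) (interchange _ _ _ _)

  sum-× : ∀ n k (F : ℕ → A) → n × sumTo k F ≈ sumTo k (λ j → n × F j)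
  sum-× n zero F = refl
  sum-× n (suc k) F = trans (×-distrib-+ _ _ n) (+-congʳ (sum-× n k F))

  sum-first : ∀ k (F : ℕ → A) → sumTo (suc k) F ≈ F 0 + sumTo k (λ j → F (suc j))
  sum-first zero F = refl
  sum-first (suc k) F = trans (+-congʳ (sum-first k F)) (+-assoc _ _ _)

  sum-0 : ∀ k → sumTo k (λ _ → 0#) ≈ 0#
  sum-0 zero = refl
  sum-0 (suc k) = trans (+-congʳ (sum-0 k)) (+-identityʳ 0#)

  -- Moment sequences read as exponential generating functions Σ f k zᵏ/k!:
  -- the product of generating functions is the binomial convolution _⋆_,
  -- differentiation is the shift ∂, and multiplication by z is z·_.

  infixl 7 _⋆_
  _⋆_ : Moments → Moments → Moments
  (f ⋆ g) k = sumTo k (λ j → (k C j) × (f j * g (k ∸ j)))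

  ∂ : Moments → Moments
  ∂ f k = f (suc k)

  z·_ : Moments → Moments
  (z· h) k = k × h (ℕ.pred k)

  infixl 6 _⊞_
  _⊞_ : Moments → Moments → Moments
  (f ⊞ g) k = f k + g k

  infix 4 _≋_
  _≋_ : Moments → Moments → Set ℓ
  f ≋ g = ∀ k → f k ≈ g k

  ⋆-cong : ∀ {f f′ g g′ : Moments} → f ≋ f′ → g ≋ g′ → f ⋆ g ≋ f′ ⋆ g′
  ⋆-cong f≋f′ g≋g′ k = sum-cong k (λ j _ → ×-congʳ (k C j) (*-cong (f≋f′ j) (g≋g′ (k ∸ j))))

  ⋆-distribʳ : ∀ f f′ g → (f ⊞ f′) ⋆ g ≋ f ⋆ g ⊞ f′ ⋆ g
  ⋆-distribʳ f f′ g k =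
    trans (sum-cong k (λ j _ → trans (×-congʳ (k C j) (distribʳ _ _ _)) (×-distrib-+ _ _ (k C j))))
          (sum-+ k _ _)

  ⋆-distribˡ : ∀ f g g′ → f ⋆ (g ⊞ g′) ≋ f ⋆ g ⊞ f ⋆ g′
  ⋆-distribˡ f g g′ k =
    trans (sum-cong k (λ j _ → trans (×-congʳ (k C j) (distribˡ _ _ _)) (×-distrib-+ _ _ (k C j))))
          (sum-+ k _ _)

  ⋆-×ʳ : ∀ n f g → f ⋆ (λ i → n × g i) ≋ (λ k → n × (f ⋆ g) k)
  ⋆-×ʳ n f g k =
    trans (sum-cong k (λ j _ → trans (×-congʳ (k C j) (×-comm-* n _ _)) (×-swap (k C j) n _)))
          (sym (sum-× n k _))

  ⋆-zeroʳ : ∀ f g → g ≋ (λ _ → 0#) → f ⋆ g ≋ (λ _ → 0#)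
  ⋆-zeroʳ f g g≋0 k = trans (sum-cong k (λ j _ → term-zero (k C j) j)) (sum-0 k)
    where
    term-zero : ∀ m j → m × (f j * g (k ∸ j)) ≈ 0#
    term-zero m j = begin
      m × (f j * g (k ∸ j))  ≈⟨ ×-congʳ m (trans (*-congˡ (g≋0 (k ∸ j))) (trans (zeroʳ _) (sym (zeroˡ 0#)))) ⟩
      m × (0# * 0#)          ≈⟨ ×-comm-* m 0# 0# ⟨
      0# * (m × 0#)          ≈⟨ zeroˡ _ ⟩
      0#                     ∎

  -- Leibniz rule ∂(f ⋆ g) = ∂f ⋆ g + f ⋆ ∂g, from Pascal's rule.
  leibniz : ∀ f g → ∂ (f ⋆ g) ≋ ∂ f ⋆ g ⊞ f ⋆ ∂ g
  leibniz f g k = begin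
      (f ⋆ g) (suc k)
    ≈⟨ sum-first k _ ⟩
      T 0 + sumTo k (λ j → (suc k C suc j) × (f (suc j) * g (k ∸ j)))
    ≈⟨ +-congˡ (sum-cong k (λ j _ → pascal j)) ⟩
      T 0 + sumTo k (λ j → (k C j) × (f (suc j) * g (k ∸ j)) + (k C suc j) × (f (suc j) * g (k ∸ j)))
    ≈⟨ +-congˡ (sum-+ k _ _) ⟩
      T 0 + ((∂ f ⋆ g) k + sumTo k (λ j → T (suc j)))
    ≈⟨ x∙yz≈y∙xz _ _ _ ⟩
      (∂ f ⋆ g) k + (T 0 + sumTo k (λ j → T (suc j)))
    ≈⟨ +-congˡ (sym (sum-first k T)) ⟩
      (∂ f ⋆ g) k + (sumTo k T + T (suc k))
    ≈⟨ +-congˡ (trans (+-congˡ last-vanishes) (+-identityʳ _)) ⟩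
      (∂ f ⋆ g) k + sumTo k T
    ≈⟨ +-congˡ (sum-cong k (λ j j≤k → ×-congʳ (k C j) (*-congˡ (reflexive (Eq.cong g (ℕP.+-∸-assoc 1 j≤k)))))) ⟩
      (∂ f ⋆ g) k + (f ⋆ ∂ g) k
    ∎
    where
    T : ℕ → A
    T j = (k C j) × (f j * g (suc k ∸ j))
    pascal : ∀ j → (suc k C suc j) × (f (suc j) * g (k ∸ j))
                   ≈ (k C j) × (f (suc j) * g (k ∸ j)) + (k C suc j) × (f (suc j) * g (k ∸ j))
    pascal j = trans (×-congˡ (Eq.sym (nCk+nC[k+1]≡[n+1]C[k+1] k j))) (×-homo-+ _ (k C j) (k C suc j))
    last-vanishes : T (suc k) ≈ 0#
    last-vanishes = ×-congˡ (k>n⇒nCk≡0 (ℕP.n<1+n k))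

  -- Commutativity and associativity of ⋆, by induction on the index via Leibniz.
  ⋆-comm : ∀ f g → f ⋆ g ≋ g ⋆ f
  ⋆-comm f g zero = ×-congʳ 1 (*-comm _ _)
  ⋆-comm f g (suc k) = begin
      (f ⋆ g) (suc k)                ≈⟨ leibniz f g k ⟩
      (∂ f ⋆ g) k + (f ⋆ ∂ g) k      ≈⟨ +-cong (⋆-comm (∂ f) g k) (⋆-comm f (∂ g) k) ⟩
      (g ⋆ ∂ f) k + (∂ g ⋆ f) k      ≈⟨ +-comm _ _ ⟩
      (∂ g ⋆ f) k + (g ⋆ ∂ f) k      ≈⟨ leibniz g f k ⟨
      (g ⋆ f) (suc k)                ∎

  ⋆-assoc : ∀ f g h → (f ⋆ g) ⋆ h ≋ f ⋆ (g ⋆ h)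
  ⋆-assoc f g h zero =
    ×-congʳ 1 (trans (×-assoc-* 1 _ _) (trans (×-congʳ 1 (*-assoc _ _ _)) (sym (×-comm-* 1 _ _))))
  ⋆-assoc f g h (suc k) = begin
      ((f ⋆ g) ⋆ h) (suc k)
    ≈⟨ leibniz (f ⋆ g) h k ⟩
      (∂ (f ⋆ g) ⋆ h) k + ((f ⋆ g) ⋆ ∂ h) k
    ≈⟨ +-congʳ (trans (⋆-cong {g = h} (leibniz f g) (λ _ → refl) k) (⋆-distribʳ (∂ f ⋆ g) (f ⋆ ∂ g) h k)) ⟩
      (((∂ f ⋆ g) ⋆ h) k + ((f ⋆ ∂ g) ⋆ h) k) + ((f ⋆ g) ⋆ ∂ h) k
    ≈⟨ +-cong (+-cong (⋆-assoc (∂ f) g h k) (⋆-assoc f (∂ g) h k)) (⋆-assoc f g (∂ h) k) ⟩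
      ((∂ f ⋆ (g ⋆ h)) k + (f ⋆ (∂ g ⋆ h)) k) + (f ⋆ (g ⋆ ∂ h)) k
    ≈⟨ +-assoc _ _ _ ⟩
      (∂ f ⋆ (g ⋆ h)) k + ((f ⋆ (∂ g ⋆ h)) k + (f ⋆ (g ⋆ ∂ h)) k)
    ≈⟨ +-congˡ (trans (⋆-cong {f = f} (λ _ → refl) (leibniz g h) k) (⋆-distribˡ f (∂ g ⋆ h) (g ⋆ ∂ h) k)) ⟨
      (∂ f ⋆ (g ⋆ h)) k + (f ⋆ ∂ (g ⋆ h)) k
    ≈⟨ leibniz f (g ⋆ h) k ⟨
      (f ⋆ (g ⋆ h)) (suc k)
    ∎

  ∂z· : ∀ h → ∂ (z· h) ≋ h ⊞ z· ∂ h
  ∂z· h zero = refl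
  ∂z· h (suc k) = refl

  z·-⋆ : ∀ h x p → (z· h ⋆ x) (suc p) ≈ suc p × (h ⋆ x) p
  z·-⋆ h x zero =
    trans (+-cong (trans (+-identityʳ _) (zeroˡ _)) (trans (+-identityʳ _) (*-congʳ (+-identityʳ _))))
          (trans (+-identityˡ _) (sym (trans (+-identityʳ _) (+-identityʳ _))))
  z·-⋆ h x (suc p) = begin
      (z· h ⋆ x) (suc (suc p))
    ≈⟨ leibniz (z· h) x (suc p) ⟩
      (∂ (z· h) ⋆ x) (suc p) + (z· h ⋆ ∂ x) (suc p)
    ≈⟨ +-cong (trans (⋆-cong {g = x} (∂z· h) (λ _ → refl) (suc p)) (⋆-distribʳ h (z· ∂ h) x (suc p))) (z·-⋆ h (∂ x) p) ⟩
      ((h ⋆ x) (suc p) + (z· ∂ h ⋆ x) (suc p)) + suc p × (h ⋆ ∂ x) p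
    ≈⟨ +-congʳ (+-congˡ (z·-⋆ (∂ h) x p)) ⟩
      ((h ⋆ x) (suc p) + suc p × (∂ h ⋆ x) p) + suc p × (h ⋆ ∂ x) p
    ≈⟨ +-assoc _ _ _ ⟩
      (h ⋆ x) (suc p) + (suc p × (∂ h ⋆ x) p + suc p × (h ⋆ ∂ x) p)
    ≈⟨ +-congˡ (trans (×-congʳ (suc p) (leibniz h x p)) (×-distrib-+ _ _ (suc p))) ⟨
      (h ⋆ x) (suc p) + suc p × (h ⋆ x) (suc p)
    ∎

  ⋆-exchange : ∀ f g h → f ⋆ (g ⋆ h) ≋ g ⋆ (f ⋆ h)
  ⋆-exchange f g h k = begin
    (f ⋆ (g ⋆ h)) k  ≈⟨ ⋆-assoc f g h k ⟨
    ((f ⋆ g) ⋆ h) k  ≈⟨ ⋆-cong {g = h} (⋆-comm f g) (λ _ → refl) k ⟩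
    ((g ⋆ f) ⋆ h) k  ≈⟨ ⋆-assoc g f h k ⟩
    (g ⋆ (f ⋆ h)) k  ∎

  -- Moments of the dot-product umbrae n·α: the generating function of n·α is
  -- the n-th power of that of α.
  module Powers (a : Moments) where

    pow : ℕ → Moments
    pow n = dotMoments n a

    pow-suc : ∀ n → pow (suc n) ≋ a ⋆ pow n
    pow-suc n k = sum-cong k (λ j _ → reflexive (×ₙ≡× (k C j) _))

    pow-mass : a 0 ≈ 1# → ∀ n → pow n 0 ≈ 1#
    pow-mass a₀≈1 zero = refl
    pow-mass a₀≈1 (suc n) = trans (+-identityʳ _) (trans (*-cong a₀≈1 (pow-mass a₀≈1 n)) (*-identityˡ 1#))

    ∂-pow : ∀ n → ∂ (pow (suc n)) ≋ (λ k → suc n × (∂ a ⋆ pow n) k)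
    ∂-pow zero k =
      trans (pow-suc 0 (suc k))
            (trans (leibniz a (pow 0) k) (+-congˡ (⋆-zeroʳ a (∂ (pow 0)) (λ _ → refl) k)))
    ∂-pow (suc n) k = begin
        pow (suc (suc n)) (suc k)
      ≈⟨ pow-suc (suc n) (suc k) ⟩
        (a ⋆ pow (suc n)) (suc k)
      ≈⟨ leibniz a (pow (suc n)) k ⟩
        (∂ a ⋆ pow (suc n)) k + (a ⋆ ∂ (pow (suc n))) k
      ≈⟨ +-congˡ (⋆-cong {f = a} (λ _ → refl) (∂-pow n) k) ⟩
        (∂ a ⋆ pow (suc n)) k + (a ⋆ (λ i → suc n × (∂ a ⋆ pow n) i)) k
      ≈⟨ +-congˡ (⋆-×ʳ (suc n) a (∂ a ⋆ pow n) k) ⟩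
        (∂ a ⋆ pow (suc n)) k + suc n × (a ⋆ (∂ a ⋆ pow n)) k
      ≈⟨ +-congˡ (×-congʳ (suc n) (⋆-exchange a (∂ a) (pow n) k)) ⟩
        (∂ a ⋆ pow (suc n)) k + suc n × (∂ a ⋆ (a ⋆ pow n)) k
      ≈⟨ +-congˡ (×-congʳ (suc n) (⋆-cong {f = ∂ a} (λ _ → refl) (pow-suc n) k)) ⟨
        (∂ a ⋆ pow (suc n)) k + suc n × (∂ a ⋆ pow (suc n)) k
      ∎

    -- The theorem at the level of generating functions, for n = m + 2:
    --   [∂(z g) · aⁿ]_{m+1} = n [∂(g a) · aⁿ⁻¹]_m .
    -- Expanding ∂(z g) = g + z ∂g and aⁿ = a · aⁿ⁻¹, both sides become
    -- n ([∂g · a · aⁿ⁻¹]_m + [g · ∂a · aⁿ⁻¹]_m).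
    abel-derivative : ∀ g m →
      (∂ (z· g) ⋆ pow (suc (suc m))) (suc m) ≈ suc (suc m) × (∂ (g ⋆ a) ⋆ pow (suc m)) m
    abel-derivative g m = begin
        (∂ (z· g) ⋆ x) (suc m)
      ≈⟨ trans (⋆-cong {g = x} (∂z· g) (λ _ → refl) (suc m)) (⋆-distribʳ g (z· ∂ g) x (suc m)) ⟩
        (g ⋆ x) (suc m) + (z· ∂ g ⋆ x) (suc m)
      ≈⟨ +-cong (leibniz g x m) (z·-⋆ (∂ g) x m) ⟩
        (U + (g ⋆ ∂ x) m) + suc m × U
      ≈⟨ +-congʳ (+-congˡ (trans (⋆-cong {f = g} (λ _ → refl) (∂-pow (suc m)) m) (⋆-×ʳ n g (∂ a ⋆ y) m))) ⟩
        (U + n × V) + suc m × U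
      ≈⟨ xy∙z≈xz∙y U (n × V) (suc m × U) ⟩
        n × U + n × V
      ≈⟨ ×-distrib-+ U V n ⟨
        n × (U + V)
      ≈⟨ ×-congʳ n (+-cong (trans (⋆-cong {f = ∂ g} (λ _ → refl) (pow-suc (suc m)) m) (sym (⋆-assoc (∂ g) a y m)))
                            (sym (⋆-assoc g (∂ a) y m))) ⟩
        n × (((∂ g ⋆ a) ⋆ y) m + ((g ⋆ ∂ a) ⋆ y) m)
      ≈⟨ ×-congʳ n (trans (⋆-cong {g = y} (leibniz g a) (λ _ → refl) m) (⋆-distribʳ (∂ g ⋆ a) (g ⋆ ∂ a) y m)) ⟨
        n × (∂ (g ⋆ a) ⋆ y) m
      ∎
      where
      n : ℕ
      n = suc (suc m)
      x y : Moments
      x = pow n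
      y = pow (suc m)
      U V : A
      U = (∂ g ⋆ x) m
      V = (g ⋆ (∂ a ⋆ y)) m

  Env : ℕ → Set c
  Env k = Fin k → Moments

  E-++ : ∀ {k} (μ : Env k) p q → E μ (p ⊕ q) ≈ E μ p + E μ q
  E-++ μ [] q = sym (+-identityˡ _)
  E-++ μ ((a , m) ∷ p) q = trans (+-congˡ (E-++ μ p q)) (sym (+-assoc _ _ _))

  E-cong : ∀ {k} {μ ν : Env k} → (∀ i n → μ i n ≈ ν i n) → ∀ p → E μ p ≈ E ν p
  E-cong μ≈ν [] = refl
  E-cong μ≈ν ((a , m) ∷ p) = +-cong (*-congˡ (evalMon-cong μ≈ν m)) (E-cong μ≈ν p)
    where
    evalMon-cong : ∀ {k} {μ ν : Env k} → (∀ i n → μ i n ≈ ν i n) → ∀ m → evalMon μ m ≈ evalMon ν m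
    evalMon-cong μ≈ν [] = refl
    evalMon-cong μ≈ν (e ∷ m) = *-cong (μ≈ν zero e) (evalMon-cong (λ i → μ≈ν (suc i)) m)

  shiftE : ∀ {k} → Vec ℕ k → Env k → Env k
  shiftE e μ i n = μ i (V.lookup e i ℕ.+ n)

  evalMon-shift : ∀ {k} (μ : Env k) (e m : Vec ℕ k) →
    evalMon μ (V.zipWith ℕ._+_ e m) Eq.≡ evalMon (shiftE e μ) m
  evalMon-shift μ [] [] = Eq.refl
  evalMon-shift μ (e ∷ es) (m ∷ ms) = Eq.cong (μ zero (e ℕ.+ m) *_) (evalMon-shift (λ i → μ (suc i)) es ms)

  E-term⊗ : ∀ {k} (μ : Env k) a e q → E μ (((a , e) ∷ []) ⊗ q) ≈ a * E (shiftE e μ) q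
  E-term⊗ μ a e [] = sym (zeroʳ a)
  E-term⊗ μ a e ((b , m) ∷ q) = begin
    a * b * evalMon μ (V.zipWith ℕ._+_ e m) + E μ (((a , e) ∷ []) ⊗ q)
      ≈⟨ +-cong (*-congˡ (reflexive (evalMon-shift μ e m))) (E-term⊗ μ a e q) ⟩
    a * b * evalMon (shiftE e μ) m + a * E (shiftE e μ) q
      ≈⟨ +-congʳ (*-assoc _ _ _) ⟩
    a * (b * evalMon (shiftE e μ) m) + a * E (shiftE e μ) q
      ≈⟨ distribˡ _ _ _ ⟨
    a * E (shiftE e μ) ((b , m) ∷ q)
      ∎

  E-cons⊗ : ∀ {k} (μ : Env k) a e p q →
    E μ (((a , e) ∷ p) ⊗ q) ≈ a * E (shiftE e μ) q + E μ (p ⊗ q)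
  E-cons⊗ {k} μ a e p q = trans (split _ (a , e) p) (+-congʳ (E-term⊗ μ a e q))
    where
    split : ∀ (F : A Prod.× Monomial k → UPoly k) t p →
      E μ (L.concatMap F (t ∷ p)) ≈ E μ (L.concatMap F (t ∷ [])) + E μ (L.concatMap F p)
    split F t p = trans (E-++ μ (F t) _) (+-congʳ (sym (trans (E-++ μ (F t) []) (+-identityʳ _))))

  E-const⊗ : ∀ {k} (μ : Env k) b q → E μ (const b ⊗ q) ≈ b * E μ q
  E-const⊗ {k} μ b q = trans (E-term⊗ μ b _ q) (*-congˡ (E-cong no-shift q))
    where
    no-shift : ∀ i n → shiftE (V.replicate k 0) μ i n ≈ μ i n
    no-shift i n = reflexive (Eq.cong (λ e → μ i (e ℕ.+ n)) (VP.lookup-replicate i 0))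

  z·-first : ∀ {k} → Env (suc k) → Env (suc k)
  z·-first μ zero = z· μ zero
  z·-first μ (suc i) = μ (suc i)

  -- Differentiating with respect to the first umbra before evaluating is the
  -- same as multiplying its generating function by z: e·c·u^(e-1) ↦ c·(z·h)_e.
  E-D : ∀ {k} (μ : Env (suc k)) p → E μ (D zero p) ≈ E (z·-first μ) p
  E-D μ [] = refl
  E-D μ ((a , e ∷ es) ∷ p) = +-cong term (E-D μ p)
    where
    rest : A
    rest = μ zero (ℕ.pred e) * evalMon (λ i → μ (suc i)) es
    term : (e ×ₙ a) * rest ≈ a * ((e × μ zero (ℕ.pred e)) * evalMon (λ i → μ (suc i)) es)
    term = begin
      (e ×ₙ a) * rest                                 ≈⟨ *-congʳ (reflexive (×ₙ≡× e a)) ⟩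
      (e × a) * rest                                  ≈⟨ ×-assoc-* e a rest ⟩
      e × (a * rest)                                  ≈⟨ ×-comm-* e a rest ⟨
      a * (e × rest)                                  ≈⟨ *-congˡ (×-assoc-* e _ _) ⟨
      a * ((e × μ zero (ℕ.pred e)) * evalMon (λ i → μ (suc i)) es) ∎

  exponentOf : Fin 4 → Monomial 4
  exponentOf zero = 1 ∷ 0 ∷ 0 ∷ 0 ∷ []
  exponentOf (suc zero) = 0 ∷ 1 ∷ 0 ∷ 0 ∷ []
  exponentOf (suc (suc zero)) = 0 ∷ 0 ∷ 1 ∷ 0 ∷ []
  exponentOf (suc (suc (suc zero))) = 0 ∷ 0 ∷ 0 ∷ 1 ∷ []

  E-atom⊗ : ∀ (μ : Env 4) i p q → E μ ((atom i ⊕ p) ⊗ q) ≈ E (shiftE (exponentOf i) μ) q + E μ (p ⊗ q)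
  E-atom⊗ μ zero p q = trans (E-cons⊗ μ 1# _ p q) (+-congʳ (*-identityˡ _))
  E-atom⊗ μ (suc zero) p q = trans (E-cons⊗ μ 1# _ p q) (+-congʳ (*-identityˡ _))
  E-atom⊗ μ (suc (suc zero)) p q = trans (E-cons⊗ μ 1# _ p q) (+-congʳ (*-identityˡ _))
  E-atom⊗ μ (suc (suc (suc zero))) p q = trans (E-cons⊗ μ 1# _ p q) (+-congʳ (*-identityˡ _))

  E-γ+nα : ∀ m (μ : Env 4) → μ α′ᵘ 0 ≈ 1# → μ n-1αᵘ 0 ≈ 1# →
    E μ ((atom γᵘ ⊕ atom nαᵘ) ^ᵖ m) ≈ (μ γᵘ ⋆ μ nαᵘ) m
  E-γ+nα zero μ α′₀≈1 d₀≈1 = begin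
    E μ 1ᵖ
      ≈⟨ +-congʳ (*-identityˡ _) ⟩
    μ γᵘ 0 * (μ α′ᵘ 0 * (μ nαᵘ 0 * (μ n-1αᵘ 0 * 1#))) + 0#
      ≈⟨ +-congʳ (*-congˡ (trans (*-cong α′₀≈1 (*-congˡ (trans (*-identityʳ _) d₀≈1)))
                                  (trans (*-identityˡ _) (*-identityʳ _)))) ⟩
    μ γᵘ 0 * μ nαᵘ 0 + 0#
      ∎
  E-γ+nα (suc m) μ α′₀≈1 d₀≈1 = begin
    E μ ((atom γᵘ ⊕ atom nαᵘ) ⊗ P)
      ≈⟨ trans (E-atom⊗ μ γᵘ (atom nαᵘ) P) (+-congˡ (trans (E-atom⊗ μ nαᵘ [] P) (+-identityʳ _))) ⟩
    E (shiftE (exponentOf γᵘ) μ) P + E (shiftE (exponentOf nαᵘ) μ) P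
      ≈⟨ +-cong (E-γ+nα m _ α′₀≈1 d₀≈1) (E-γ+nα m _ α′₀≈1 d₀≈1) ⟩
    (∂ (μ γᵘ) ⋆ μ nαᵘ) m + (μ γᵘ ⋆ ∂ (μ nαᵘ)) m
      ≈⟨ leibniz (μ γᵘ) (μ nαᵘ) m ⟨
    (μ γᵘ ⋆ μ nαᵘ) (suc m)
      ∎
    where
    P : UPoly 4
    P = (atom γᵘ ⊕ atom nαᵘ) ^ᵖ m

  E-γ+α′+d : ∀ m (μ : Env 4) → μ nαᵘ 0 ≈ 1# →
    E μ ((atom γᵘ ⊕ atom α′ᵘ ⊕ atom n-1αᵘ) ^ᵖ m) ≈ ((μ γᵘ ⋆ μ α′ᵘ) ⋆ μ n-1αᵘ) m
  E-γ+α′+d zero μ n₀≈1 = begin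
    E μ 1ᵖ
      ≈⟨ +-congʳ (*-identityˡ _) ⟩
    μ γᵘ 0 * (μ α′ᵘ 0 * (μ nαᵘ 0 * (μ n-1αᵘ 0 * 1#))) + 0#
      ≈⟨ +-congʳ (*-congˡ (*-congˡ (trans (*-cong n₀≈1 (*-identityʳ _)) (*-identityˡ _)))) ⟩
    μ γᵘ 0 * (μ α′ᵘ 0 * μ n-1αᵘ 0) + 0#
      ≈⟨ +-congʳ (trans (sym (*-assoc _ _ _)) (*-congʳ (sym (+-identityʳ _)))) ⟩
    (μ γᵘ 0 * μ α′ᵘ 0 + 0#) * μ n-1αᵘ 0 + 0#
      ∎
  E-γ+α′+d (suc m) μ n₀≈1 = begin
    E μ ((atom γᵘ ⊕ atom α′ᵘ ⊕ atom n-1αᵘ) ⊗ P)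
      ≈⟨ trans (E-atom⊗ μ γᵘ (atom α′ᵘ ⊕ atom n-1αᵘ) P) (+-congˡ (trans (E-atom⊗ μ α′ᵘ (atom n-1αᵘ) P)
               (+-congˡ (trans (E-atom⊗ μ n-1αᵘ [] P) (+-identityʳ _))))) ⟩
    E (shiftE (exponentOf γᵘ) μ) P + (E (shiftE (exponentOf α′ᵘ) μ) P + E (shiftE (exponentOf n-1αᵘ) μ) P)
      ≈⟨ +-cong (E-γ+α′+d m _ n₀≈1) (+-cong (E-γ+α′+d m _ n₀≈1) (E-γ+α′+d m _ n₀≈1)) ⟩
    ((∂ f ⋆ f′) ⋆ d) m + (((f ⋆ ∂ f′) ⋆ d) m + ((f ⋆ f′) ⋆ ∂ d) m)
      ≈⟨ +-assoc _ _ _ ⟨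
    (((∂ f ⋆ f′) ⋆ d) m + ((f ⋆ ∂ f′) ⋆ d) m) + ((f ⋆ f′) ⋆ ∂ d) m
      ≈⟨ +-congʳ (trans (⋆-cong {g = d} (leibniz f f′) (λ _ → refl) m) (⋆-distribʳ (∂ f ⋆ f′) (f ⋆ ∂ f′) d m)) ⟨
    (∂ (f ⋆ f′) ⋆ d) m + ((f ⋆ f′) ⋆ ∂ d) m
      ≈⟨ leibniz (f ⋆ f′) d m ⟨
    ((f ⋆ f′) ⋆ d) (suc m)
      ∎
    where
    P : UPoly 4
    P = (atom γᵘ ⊕ atom α′ᵘ ⊕ atom n-1αᵘ) ^ᵖ m
    f f′ d : Moments
    f = μ γᵘ
    f′ = μ α′ᵘ
    d = μ n-1αᵘ

  module Sides (a g : Moments) (a₀≈1 : a 0 ≈ 1#) where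
    open Powers a

    E-lhs : ∀ m → E (abelEnv (suc m) a g) (D γᵘ (ab (suc m) (atom γᵘ) (atom nαᵘ)))
                  ≈ (∂ (z· g) ⋆ pow (suc m)) m
    E-lhs m = begin
      E μ (D γᵘ (atom γᵘ ⊗ P))                           ≈⟨ E-D μ (atom γᵘ ⊗ P) ⟩
      E (z·-first μ) (atom γᵘ ⊗ P)                       ≈⟨ trans (E-atom⊗ (z·-first μ) γᵘ [] P) (+-identityʳ _) ⟩
      E (shiftE (exponentOf γᵘ) (z·-first μ)) P          ≈⟨ E-γ+nα m _ a₀≈1 (pow-mass a₀≈1 m) ⟩
      (∂ (z· g) ⋆ pow (suc m)) m                         ∎
      where
      μ : Env 4
      μ = abelEnv (suc m) a g
      P : UPoly 4
      P = (atom γᵘ ⊕ atom nαᵘ) ^ᵖ m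

    E-rhs : ∀ N m → E (abelEnv N a g) (ab (suc m) (atom γᵘ ⊕ atom α′ᵘ) (atom n-1αᵘ))
                    ≈ (∂ (g ⋆ a) ⋆ pow (N ∸ 1)) m
    E-rhs N m = begin
      E μ ((atom γᵘ ⊕ atom α′ᵘ) ⊗ Q)
        ≈⟨ trans (E-atom⊗ μ γᵘ (atom α′ᵘ) Q) (+-congˡ (trans (E-atom⊗ μ α′ᵘ [] Q) (+-identityʳ _))) ⟩
      E (shiftE (exponentOf γᵘ) μ) Q + E (shiftE (exponentOf α′ᵘ) μ) Q
        ≈⟨ +-cong (E-γ+α′+d m _ (pow-mass a₀≈1 N)) (E-γ+α′+d m _ (pow-mass a₀≈1 N)) ⟩
      ((∂ g ⋆ a) ⋆ d) m + ((g ⋆ ∂ a) ⋆ d) m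
        ≈⟨ trans (⋆-cong {g = d} (leibniz g a) (λ _ → refl) m) (⋆-distribʳ (∂ g ⋆ a) (g ⋆ ∂ a) d m) ⟨
      (∂ (g ⋆ a) ⋆ d) m
        ∎
      where
      μ : Env 4
      μ = abelEnv N a g
      Q : UPoly 4
      Q = (atom γᵘ ⊕ atom α′ᵘ ⊕ atom n-1αᵘ) ^ᵖ m
      d : Moments
      d = pow (N ∸ 1)

    abel-moments : ∀ m → (∂ (z· g) ⋆ pow (suc m)) m
                         ≈ suc m × E (abelEnv (suc m) a g) (ab m (atom γᵘ ⊕ atom α′ᵘ) (atom n-1αᵘ))
    abel-moments zero = begin
      (∂ (z· g) ⋆ pow 1) 0      ≈⟨ ×-congʳ 1 (*-congʳ (×-homo-1 (g 0))) ⟩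
      (g ⋆ pow 1) 0             ≈⟨ E-γ+nα 0 (abelEnv 1 a g) a₀≈1 refl ⟨
      E (abelEnv 1 a g) 1ᵖ      ≈⟨ ×-homo-1 _ ⟨
      1 × E (abelEnv 1 a g) 1ᵖ  ∎
    abel-moments (suc m) =
      trans (abel-derivative g m) (×-congʳ (suc (suc m)) (sym (E-rhs (suc (suc m)) m)))

  E-multiple⊗ : ∀ {k} (μ : Env k) n q → E μ (const (n ×ₙ 1#) ⊗ q) ≈ n × E μ q
  E-multiple⊗ μ n q = begin
    E μ (const (n ×ₙ 1#) ⊗ q)  ≈⟨ E-const⊗ μ (n ×ₙ 1#) q ⟩
    (n ×ₙ 1#) * E μ q          ≈⟨ *-congʳ (reflexive (×ₙ≡× n 1#)) ⟩
    (n × 1#) * E μ q           ≈⟨ ×-assoc-* n 1# _ ⟩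
    n × (1# * E μ q)           ≈⟨ ×-congʳ n (*-identityˡ _) ⟩
    n × E μ q                  ∎

mainTheorem1 : ∀ {c ℓ} (R : CommutativeRing c ℓ) →
    let open CommutativeRing R
        open Umbral R
    in (a g : ℕ → Carrier) → a 0 ≈ 1# → g 0 ≈ 1# →
       (n : ℕ) → 1 ≤ n →
       D γᵘ (ab n (atom γᵘ) (atom nαᵘ))
         ≃⟨ abelEnv n a g ⟩
       const (n ×ₙ 1#) ⊗ ab (n ∸ 1) (atom γᵘ ⊕ atom α′ᵘ) (atom n-1αᵘ)
mainTheorem1 R a g a₀≈1 _ (suc m) _ = begin
    E μ (D γᵘ (ab (suc m) (atom γᵘ) (atom nαᵘ)))
  ≈⟨ E-lhs m ⟩
    (∂ (z· g) ⋆ pow (suc m)) m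
  ≈⟨ abel-moments m ⟩
    suc m × E μ (ab m (atom γᵘ ⊕ atom α′ᵘ) (atom n-1αᵘ))
  ≈⟨ E-multiple⊗ μ (suc m) (ab m (atom γᵘ ⊕ atom α′ᵘ) (atom n-1αᵘ)) ⟨
    E μ (const (suc m ×ₙ 1#) ⊗ ab m (atom γᵘ ⊕ atom α′ᵘ) (atom n-1αᵘ))
  ∎
  where
  open CommutativeRing R
  open Umbral R
  open AbelCalculus R
  open Powers a
  open Sides a g a₀≈1
  open import Relation.Binary.Reasoning.Setoid setoid
  open SemiringMult semiring using (_×_)
  μ : Fin 4 → Moments
  μ = abelEnv (suc m) a g
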